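{- For every prime $p$ and every odd positive integer $k$ we have $Q(p^k)=0$.
   Context: For integers $\alpha,\beta$ define $\lambda_{\alpha,\beta}(n)$ for $n\ge1$ by: $\lambda_{\alpha,\beta}(1)=1$; $\lambda_{\alpha,\beta}(2^k)=0$ for $k\ge1$; for odd primes $p$, $\lambda_{\alpha,\beta}(p)=-p^{ -1/2}\sum_{x\bmod p}\left(\frac{x^3+\alpha x+\beta}{p}\right)$ (Legendre symbol) and $\sum_{k\ge0}\lambda_{\alpha,\beta}(p^k)x^k=(1-\lambda_{\alpha,\beta}(p)x+\psi(p)x^2)^{ -1}$ where $\psi(p)=0$ if $p\mid4\alpha^3+27\beta^2$ and $\psi(p)=1$ otherwise; and $\lambda_{\alpha,\beta}$ is multiplicative in $n$. Then $\lambda_{\alpha,\beta}(n)$ depends only on $\alpha,\beta$ modulo $n^*=\prod_{p\mid n}p$, and $Q(n)=\sum_{\alpha\bmod n^*}\sum_{\beta\bmod n^*}\lambda_{\alpha,\beta}(n)$. -}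

module Defs where

open import Data.Bool using (Bool; true; false; if_then_else_)
open import Data.Nat as ℕ using (ℕ; zero; suc; _≡ᵇ_)
open import Data.Nat.DivMod using (_%_)
open import Data.Product using (_×_; _,_; proj₁)
open import Data.Integer as ℤ using (ℤ; +_; -_; _-_; 0ℤ; 1ℤ)

-- a mod m (with the convention a mod 0 = a; only used for primes m)
modN : ℕ → ℕ → ℕ
modN a zero    = a
modN a (suc m) = a % suc m

isSquareBelow : ℕ → ℕ → ℕ → Bool
isSquareBelow p a zero    = false
isSquareBelow p a (suc n) =
  if modN (n ℕ.* n) p ≡ᵇ modN a p then true else isSquareBelow p a n

legendre : ℕ → ℕ → ℤ
legendre a p =
  if modN a p ≡ᵇ 0 then 0ℤ
  else (if isSquareBelow p a p then 1ℤ else - 1ℤ)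

sumℤ : ℕ → (ℕ → ℤ) → ℤ
sumℤ zero    f = 0ℤ
sumℤ (suc n) f = sumℤ n f ℤ.+ f n

-- a_p(α,β) = Σ_{x mod p} ((x³ + αx + β) / p)   (so λ(p) = - a_p / √p)
traceA : ℕ → ℕ → ℕ → ℤ
traceA p α β = sumℤ p (λ x → legendre (x ℕ.* x ℕ.* x ℕ.+ α ℕ.* x ℕ.+ β) p)

psi : ℕ → ℕ → ℕ → ℤ
psi p α β =
  if modN (4 ℕ.* (α ℕ.* α ℕ.* α) ℕ.+ 27 ℕ.* (β ℕ.* β)) p ≡ᵇ 0 then 0ℤ else 1ℤ

-- Scaled coefficients: μ_k = p^{k/2} · λ_{α,β}(p^k) for odd primes p.
-- From (1 - λ(p) x + ψ(p) x²)⁻¹ = Σ λ(p^k) x^k we get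
--   λ(p^{k+2}) = λ(p) λ(p^{k+1}) - ψ(p) λ(p^k),  λ(1)=1, λ(p) = -a_p/√p,
-- hence μ_0 = 1, μ_1 = -a_p, μ_{k+2} = -a_p μ_{k+1} - p ψ(p) μ_k  (all integers).
-- Returns the pair (μ_k , μ_{k+1}).
muPair : ℤ → ℤ → ℕ → ℕ → ℤ × ℤ
muPair a ψ p zero    = 1ℤ , - a
muPair a ψ p (suc k) with muPair a ψ p k
... | (u , v) = v , ((- a) ℤ.* v - (+ p) ℤ.* ψ ℤ.* u)

-- scaledLambda p k α β = p^{k/2} · λ_{α,β}(p^k) for a prime p
-- (for p = 2: λ(1) = 1 and λ(2^k) = 0 for k ≥ 1)
scaledLambda : ℕ → ℕ → ℕ → ℕ → ℤ
scaledLambda p zero    α β = 1ℤ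
scaledLambda p (suc k) α β =
  if p ≡ᵇ 2 then 0ℤ
  else proj₁ (muPair (traceA p α β) (psi p α β) p (suc k))

-- scaledQ p k = p^{k/2} · Q(p^k) = Σ_{α mod p} Σ_{β mod p} p^{k/2} λ_{α,β}(p^k)
-- (for k ≥ 1, (p^k)* = p)
scaledQ : ℕ → ℕ → ℤ
scaledQ p k = sumℤ p (λ α → sumℤ p (λ β → scaledLambda p k α β))

-- Let p be an odd prime and d a quadratic non-residue mod p.  The twist (α, β) ↦ (d²α, d³β)
-- permutes the pairs mod p.  Substituting x ↦ dx turns x³ + d²αx + d³β into d³(x³ + αx + β),
-- so a_p changes sign, while the discriminant is multiplied by d⁶ and ψ is unchanged.  The
-- recursion for μ_k makes μ_k(-a) = (-1)^k μ_k(a), so for odd k every summand of Q(p^k) changes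
-- sign under the twist and the sum vanishes.  For p = 2 all summands are 0 by definition.
--
-- The rule χ(dx) = -χ(x) is obtained without multiplicativity of the Legendre symbol χ.  Every
-- nonzero square has exactly two square roots, so Σ χ = 0.  Also, d times a nonzero square is a
-- non-square.  Hence χ(x) + χ(dx) ≤ 0 for every x, and as these terms sum to 0 each of them vanishes.

module Submission where

open import Defs
open import Data.Nat using (ℕ; _+_; _*_)
open import Data.Nat.Primality using (Prime)
open import Data.Integer using (0ℤ)
open import Relation.Binary.PropositionalEquality using (_≡_)

open import Data.Bool using (true; false; if_then_else_; T)
open import Data.Empty using (⊥-elim)
open import Data.Integer as ℤ using (ℤ; +_; -_; 1ℤ; -1ℤ)
import Data.Integer.Properties as ℤₚ
open import Algebra.Properties.AbelianGroup ℤₚ.+-0-abelianGroup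
  using (identityʳ-unique; inverseʳ-unique)
import Data.Integer.Tactic.RingSolver as ℤ-Solver
open import Data.Nat
  using (zero; suc; _≡ᵇ_; _∸_; _<_; _≤_; _≟_; z≤n; NonZero; >-nonZero⁻¹; ≢-nonZero; nonTrivial⇒n>1)
open import Data.Nat.Coprimality using (coprime-Bézout; prime⇒coprime)
open import Data.Nat.DivMod
  using ( _%_; _/_; m≡m%n+[m/n]*n; [m+kn]%n≡m%n; %-distribˡ-+; %-distribˡ-*; m%n%n≡m%n
        ; m<n⇒m%n≡m; m%n<n)
open import Data.Nat.Divisibility using (_∣_; divides; m∣m*n; m%n≡0⇒n∣m; n∣m⇒m%n≡0)
open import Data.Nat.GCD using (module Bézout)
open import Data.Nat.Primality using (prime⇒nonZero; prime⇒nonTrivial; euclidsLemma; composite)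
import Data.Nat.Properties as ℕₚ
open import Data.Nat.Properties using (anyUpTo?)
import Data.Nat.Tactic.RingSolver as ℕ-Solver
open import Data.Product using (_×_; _,_; proj₁; proj₂; ∃; map₁; map₂)
open import Data.Sum as Sum using (_⊎_; inj₁; inj₂)
open import Function using (_∘_; id)
open import Relation.Binary.Bundles using (Setoid)
open import Relation.Binary.Structures using (IsEquivalence)
open import Relation.Binary.PropositionalEquality
  using (_≢_; refl; sym; trans; cong; cong₂; subst; module ≡-Reasoning)
import Relation.Binary.Reasoning.Setoid as SetoidReasoning
open import Relation.Nullary using (¬_; yes; no)

sumℤ-cong : ∀ n {f g : ℕ → ℤ} → (∀ {x} → x < n → f x ≡ g x) → sumℤ n f ≡ sumℤ n g
sumℤ-cong zero    f≗g = refl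
sumℤ-cong (suc n) f≗g =
  cong₂ ℤ._+_ (sumℤ-cong n (f≗g ∘ ℕₚ.m<n⇒m<1+n)) (f≗g (ℕₚ.n<1+n n))

sumℤ-distrib-+ : ∀ n (f g : ℕ → ℤ) →
                 sumℤ n (λ x → f x ℤ.+ g x) ≡ sumℤ n f ℤ.+ sumℤ n g
sumℤ-distrib-+ zero    f g = refl
sumℤ-distrib-+ (suc n) f g =
  trans (cong (ℤ._+ (f n ℤ.+ g n)) (sumℤ-distrib-+ n f g))
        (interchange (sumℤ n f) (sumℤ n g) (f n) (g n))
  where
  interchange : ∀ a b c d → a ℤ.+ b ℤ.+ (c ℤ.+ d) ≡ a ℤ.+ c ℤ.+ (b ℤ.+ d)
  interchange = ℤ-Solver.solve-∀

sumℤ-neg : ∀ n (f : ℕ → ℤ) → sumℤ n (λ x → - f x) ≡ - sumℤ n f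
sumℤ-neg zero    f = refl
sumℤ-neg (suc n) f =
  trans (cong (ℤ._+ - f n) (sumℤ-neg n f)) (sym (ℤₚ.neg-distrib-+ (sumℤ n f) (f n)))

sumℤ-distribʳ-* : ∀ n (f : ℕ → ℤ) c → sumℤ n (λ x → f x ℤ.* c) ≡ sumℤ n f ℤ.* c
sumℤ-distribʳ-* zero    f c = sym (ℤₚ.*-zeroˡ c)
sumℤ-distribʳ-* (suc n) f c =
  trans (cong (ℤ._+ f n ℤ.* c) (sumℤ-distribʳ-* n f c))
        (sym (ℤₚ.*-distribʳ-+ c (sumℤ n f) (f n)))

sumℤ-zero : ∀ n → sumℤ n (λ _ → 0ℤ) ≡ 0ℤ
sumℤ-zero zero    = refl
sumℤ-zero (suc n) = cong (ℤ._+ 0ℤ) (sumℤ-zero n)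

sumℤ-one : ∀ n → sumℤ n (λ _ → 1ℤ) ≡ + n
sumℤ-one zero    = refl
sumℤ-one (suc n) = trans (cong (ℤ._+ 1ℤ) (sumℤ-one n)) (ℤₚ.+-comm (+ n) 1ℤ)

sumℤ-comm : ∀ m n (F : ℕ → ℕ → ℤ) →
            sumℤ m (λ x → sumℤ n (F x)) ≡ sumℤ n (λ y → sumℤ m (λ x → F x y))
sumℤ-comm zero    n F = sym (sumℤ-zero n)
sumℤ-comm (suc m) n F =
  trans (cong (ℤ._+ sumℤ n (F m)) (sumℤ-comm m n F))
        (sym (sumℤ-distrib-+ n (λ y → sumℤ m (λ x → F x y)) (F m)))

sumℤ-nonneg : ∀ n {f : ℕ → ℤ} → (∀ {x} → x < n → 0ℤ ℤ.≤ f x) → 0ℤ ℤ.≤ sumℤ n f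
sumℤ-nonneg zero    f≥0 = ℤₚ.≤-refl
sumℤ-nonneg (suc n) f≥0 =
  ℤₚ.+-mono-≤ (sumℤ-nonneg n (f≥0 ∘ ℕₚ.m<n⇒m<1+n)) (f≥0 (ℕₚ.n<1+n n))

sumℤ-nonneg-≡0 : ∀ n {f : ℕ → ℤ} → (∀ {x} → x < n → 0ℤ ℤ.≤ f x) →
                 sumℤ n f ≡ 0ℤ → ∀ {x} → x < n → f x ≡ 0ℤ
sumℤ-nonneg-≡0 (suc n) f≥0 Σf≡0 x<1+n
  with nonneg+nonneg≡0 (sumℤ-nonneg n (f≥0 ∘ ℕₚ.m<n⇒m<1+n)) (f≥0 (ℕₚ.n<1+n n)) Σf≡0
     | ℕₚ.m<1+n⇒m<n∨m≡n x<1+n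
  where
  nonneg+nonneg≡0 : ∀ {a b} → 0ℤ ℤ.≤ a → 0ℤ ℤ.≤ b → a ℤ.+ b ≡ 0ℤ → a ≡ 0ℤ × b ≡ 0ℤ
  nonneg+nonneg≡0 {+ a} {+ b} (ℤ.+≤+ _) (ℤ.+≤+ _) a+b≡0 =
    cong +_ (ℕₚ.m+n≡0⇒m≡0 a (ℤₚ.+-injective a+b≡0)) ,
    cong +_ (ℕₚ.m+n≡0⇒n≡0 a (ℤₚ.+-injective a+b≡0))
... | Σ≡0 , _   | inj₁ x<n  = sumℤ-nonneg-≡0 n (f≥0 ∘ ℕₚ.m<n⇒m<1+n) Σ≡0 x<n
... | _   , f≡0 | inj₂ refl = f≡0

δ : ℕ → ℕ → ℤ
δ a b = if a ≡ᵇ b then 1ℤ else 0ℤ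

δ-≡ : ∀ {a b} → a ≡ b → δ a b ≡ 1ℤ
δ-≡ {a} refl with a ≡ᵇ a | ℕₚ.≡⇒≡ᵇ a a refl
... | true | _ = refl

δ-≢ : ∀ {a b} → a ≢ b → δ a b ≡ 0ℤ
δ-≢ {a} {b} a≢b with a ≡ᵇ b in eq
... | true  = ⊥-elim (a≢b (ℕₚ.≡ᵇ⇒≡ a b (subst T (sym eq) _)))
... | false = refl

δ-cong : ∀ {a b c d} → (a ≡ b → c ≡ d) → (c ≡ d → a ≡ b) → δ a b ≡ δ c d
δ-cong {a} {b} {c} {d} a≡b⇒c≡d c≡d⇒a≡b with a ≟ b | c ≟ d
... | yes a≡b | yes c≡d = trans (δ-≡ a≡b) (sym (δ-≡ c≡d))
... | yes a≡b | no  c≢d = ⊥-elim (c≢d (a≡b⇒c≡d a≡b))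
... | no  a≢b | yes c≡d = ⊥-elim (a≢b (c≡d⇒a≡b c≡d))
... | no  a≢b | no  c≢d = trans (δ-≢ a≢b) (sym (δ-≢ c≢d))

sumℤ-δ : ∀ n {c} (g : ℕ → ℤ) → c < n → sumℤ n (λ y → δ y c ℤ.* g y) ≡ g c
sumℤ-δ (suc n) {c} g c<1+n with ℕₚ.m<1+n⇒m<n∨m≡n c<1+n
... | inj₁ c<n = begin
  sumℤ n (λ y → δ y c ℤ.* g y) ℤ.+ δ n c ℤ.* g n
    ≡⟨ cong₂ (λ s e → s ℤ.+ e ℤ.* g n) (sumℤ-δ n g c<n) (δ-≢ (ℕₚ.>⇒≢ c<n)) ⟩
  g c ℤ.+ 0ℤ ℤ.* g n
    ≡⟨ ℤₚ.+-identityʳ (g c) ⟩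
  g c
    ∎
  where open ≡-Reasoning
... | inj₂ refl = begin
  sumℤ n (λ y → δ y n ℤ.* g y) ℤ.+ δ n n ℤ.* g n
    ≡⟨ cong₂ (λ s e → s ℤ.+ e ℤ.* g n) (vanishes-below n ℕₚ.≤-refl) (δ-≡ {n} refl) ⟩
  0ℤ ℤ.+ 1ℤ ℤ.* g n
    ≡⟨ ℤₚ.+-identityˡ _ ⟩
  1ℤ ℤ.* g n
    ≡⟨ ℤₚ.*-identityˡ (g n) ⟩
  g n
    ∎
  where
  open ≡-Reasoning
  vanishes-below : ∀ k → k ≤ n → sumℤ k (λ y → δ y n ℤ.* g y) ≡ 0ℤ
  vanishes-below zero    _   = refl
  vanishes-below (suc k) k<n =
    cong₂ (λ s e → s ℤ.+ e ℤ.* g k) (vanishes-below k (ℕₚ.<⇒≤ k<n)) (δ-≢ (ℕₚ.<⇒≢ k<n))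

sumℤ-δ-one : ∀ n {c} → c < n → sumℤ n (λ y → δ y c) ≡ 1ℤ
sumℤ-δ-one n {c} c<n =
  trans (sumℤ-cong n (λ {y} _ → sym (ℤₚ.*-identityʳ (δ y c)))) (sumℤ-δ n (λ _ → 1ℤ) c<n)

sumℤ-reindex : ∀ n (h h⁻¹ : ℕ → ℕ) →
               (∀ {x} → x < n → h x < n) → (∀ {y} → y < n → h⁻¹ y < n) →
               (∀ {x} → x < n → h⁻¹ (h x) ≡ x) → (∀ {y} → y < n → h (h⁻¹ y) ≡ y) →
               ∀ (g : ℕ → ℤ) → sumℤ n (g ∘ h) ≡ sumℤ n g
sumℤ-reindex n h h⁻¹ h<n h⁻¹<n left-inverse right-inverse g = begin
  sumℤ n (g ∘ h)
    ≡⟨ sumℤ-cong n (λ x<n → sumℤ-δ n g (h<n x<n)) ⟨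
  sumℤ n (λ x → sumℤ n (λ y → δ y (h x) ℤ.* g y))
    ≡⟨ sumℤ-comm n n _ ⟩
  sumℤ n (λ y → sumℤ n (λ x → δ y (h x) ℤ.* g y))
    ≡⟨ sumℤ-cong n (λ y<n → sumℤ-cong n (λ x<n →
         cong (ℤ._* _) (δ-cong (inverted x<n) (uninverted y<n)))) ⟩
  sumℤ n (λ y → sumℤ n (λ x → δ x (h⁻¹ y) ℤ.* g y))
    ≡⟨ sumℤ-cong n (λ {y} _ → sumℤ-distribʳ-* n _ (g y)) ⟩
  sumℤ n (λ y → sumℤ n (λ x → δ x (h⁻¹ y)) ℤ.* g y)
    ≡⟨ sumℤ-cong n (λ {y} y<n → cong (ℤ._* g y) (sumℤ-δ-one n (h⁻¹<n y<n))) ⟩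
  sumℤ n (λ y → 1ℤ ℤ.* g y)
    ≡⟨ sumℤ-cong n (λ {y} _ → ℤₚ.*-identityˡ (g y)) ⟩
  sumℤ n g
    ∎
  where
  open ≡-Reasoning
  inverted : ∀ {x y} → x < n → y ≡ h x → x ≡ h⁻¹ y
  inverted x<n refl = sym (left-inverse x<n)
  uninverted : ∀ {x y} → y < n → x ≡ h⁻¹ y → y ≡ h x
  uninverted y<n refl = sym (right-inverse y<n)

i≡-i⇒i≡0 : ∀ {i} → i ≡ - i → i ≡ 0ℤ
i≡-i⇒i≡0 {+ zero}     _  = refl
i≡-i⇒i≡0 {ℤ.+[1+ _ ]} ()
i≡-i⇒i≡0 {ℤ.-[1+ _ ]} ()

cubic : ℕ → ℕ → ℕ → ℕ
cubic α β x = x * x * x + α * x + β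

disc : ℕ → ℕ → ℕ
disc α β = 4 * (α * α * α) + 27 * (β * β)

module Congruence (n : ℕ) .{{_ : NonZero n}} where

  -- A record rather than a bare equation, so that a and b can be inferred from a ≈ b.
  infix 4 _≈_ _≉_
  record _≈_ (a b : ℕ) : Set where
    constructor mod-≡
    field %-≡ : a % n ≡ b % n
  open _≈_ public

  _≉_ : ℕ → ℕ → Set
  a ≉ b = ¬ (a ≈ b)

  ≈-isEquivalence : IsEquivalence _≈_
  ≈-isEquivalence = record
    { refl  = mod-≡ refl
    ; sym   = λ a≈b → mod-≡ (sym (%-≡ a≈b))
    ; trans = λ a≈b b≈c → mod-≡ (trans (%-≡ a≈b) (%-≡ b≈c))
    }

  ≈-setoid : Setoid _ _
  ≈-setoid = record { isEquivalence = ≈-isEquivalence }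

  open IsEquivalence ≈-isEquivalence public
    using () renaming (refl to ≈-refl; sym to ≈-sym; trans to ≈-trans)
  module ≈-Reasoning = SetoidReasoning ≈-setoid

  %-≈ : ∀ a → a % n ≈ a
  %-≈ a = mod-≡ (m%n%n≡m%n a n)

  +-cong : ∀ {a a' b b'} → a ≈ a' → b ≈ b' → a + b ≈ a' + b'
  +-cong {a} {a'} {b} {b'} (mod-≡ a≡a') (mod-≡ b≡b') = mod-≡ (begin
    (a + b) % n              ≡⟨ %-distribˡ-+ a b n ⟩
    (a % n + b % n) % n      ≡⟨ cong₂ (λ x y → (x + y) % n) a≡a' b≡b' ⟩
    (a' % n + b' % n) % n    ≡⟨ %-distribˡ-+ a' b' n ⟨
    (a' + b') % n            ∎)
    where open ≡-Reasoning

  *-cong : ∀ {a a' b b'} → a ≈ a' → b ≈ b' → a * b ≈ a' * b'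
  *-cong {a} {a'} {b} {b'} (mod-≡ a≡a') (mod-≡ b≡b') = mod-≡ (begin
    (a * b) % n              ≡⟨ %-distribˡ-* a b n ⟩
    (a % n * (b % n)) % n    ≡⟨ cong₂ (λ x y → (x * y) % n) a≡a' b≡b' ⟩
    (a' % n * (b' % n)) % n  ≡⟨ %-distribˡ-* a' b' n ⟨
    (a' * b') % n            ∎)
    where open ≡-Reasoning

  cubic-cong : ∀ {α α' β β' x x'} → α ≈ α' → β ≈ β' → x ≈ x' →
               cubic α β x ≈ cubic α' β' x'
  cubic-cong α≈α' β≈β' x≈x' =
    +-cong (+-cong (*-cong (*-cong x≈x' x≈x') x≈x') (*-cong α≈α' x≈x')) β≈β'

  disc-cong : ∀ {α α' β β'} → α ≈ α' → β ≈ β' → disc α β ≈ disc α' β'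
  disc-cong α≈α' β≈β' =
    +-cong (*-cong (≈-refl {4}) (*-cong (*-cong α≈α' α≈α') α≈α'))
           (*-cong (≈-refl {27}) (*-cong β≈β' β≈β'))

  %-square : ∀ a → (a % n) * (a % n) ≈ a * a
  %-square a = *-cong (%-≈ a) (%-≈ a)

  ≈⇒≡ : ∀ {a b} → a < n → b < n → a ≈ b → a ≡ b
  ≈⇒≡ a<n b<n (mod-≡ a≡b) = trans (sym (m<n⇒m%n≡m a<n)) (trans a≡b (m<n⇒m%n≡m b<n))

  0%n≡0 : 0 % n ≡ 0
  0%n≡0 = m<n⇒m%n≡m (>-nonZero⁻¹ n)

  *-≈0 : ∀ a {b} → b ≈ 0 → a * b ≈ 0
  *-≈0 a b≈0 = ≈-trans (*-cong (≈-refl {a}) b≈0) (mod-≡ (cong (_% n) (ℕₚ.*-zeroʳ a)))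

  ≈0⇒%≡0 : ∀ {a} → a ≈ 0 → a % n ≡ 0
  ≈0⇒%≡0 (mod-≡ a≡0) = trans a≡0 0%n≡0

  %≡0⇒≈0 : ∀ {a} → a % n ≡ 0 → a ≈ 0
  %≡0⇒≈0 a≡0 = mod-≡ (trans a≡0 (sym 0%n≡0))

  ≈0⇒∣ : ∀ {a} → a ≈ 0 → n ∣ a
  ≈0⇒∣ {a} = m%n≡0⇒n∣m a n ∘ ≈0⇒%≡0

  ∣⇒≈0 : ∀ {a} → n ∣ a → a ≈ 0
  ∣⇒≈0 {a} = %≡0⇒≈0 ∘ n∣m⇒m%n≡0 a n

  +-multiple : ∀ a k → a + k * n ≈ a
  +-multiple a k = mod-≡ ([m+kn]%n≡m%n a k n)

  <∧≈0⇒≡0 : ∀ {a} → a < n → a ≈ 0 → a ≡ 0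
  <∧≈0⇒≡0 a<n = ≈⇒≡ a<n (>-nonZero⁻¹ n)

  <2n∧≈0⇒≡0⊎≡n : ∀ {a} → a < n + n → a ≈ 0 → a ≡ 0 ⊎ a ≡ n
  <2n∧≈0⇒≡0⊎≡n a<2n a≈0 with ≈0⇒∣ a≈0
  ... | divides zero          refl = inj₁ refl
  ... | divides (suc zero)    refl = inj₂ (ℕₚ.+-identityʳ n)
  ... | divides (suc (suc k)) refl =
    ⊥-elim (ℕₚ.<⇒≱ a<2n (ℕₚ.+-monoʳ-≤ n (ℕₚ.m≤m+n n (k * n))))

  a+b≈a⇒b≈0 : ∀ a b → a + b ≈ a → b ≈ 0
  a+b≈a⇒b≈0 a b (mod-≡ a+b≡a) = ∣⇒≈0 (divides (Q ∸ q) (begin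
    b                                   ≡⟨ ℕₚ.m+n∸m≡n a b ⟨
    a + b ∸ a                           ≡⟨ cong₂ _∸_ (m≡m%n+[m/n]*n (a + b) n) (m≡m%n+[m/n]*n a n) ⟩
    ((a + b) % n + Q * n) ∸ (a % n + q * n)
                                        ≡⟨ cong (λ r → ((a + b) % n + Q * n) ∸ (r + q * n)) a+b≡a ⟨
    ((a + b) % n + Q * n) ∸ ((a + b) % n + q * n)
                                        ≡⟨ ℕₚ.[m+n]∸[m+o]≡n∸o ((a + b) % n) (Q * n) (q * n) ⟩
    Q * n ∸ q * n                       ≡⟨ ℕₚ.*-distribʳ-∸ n Q q ⟨
    (Q ∸ q) * n                         ∎))
    where
    open ≡-Reasoning
    Q q : ℕ
    Q = (a + b) / n
    q = a / n

  inverse-* : ∀ a a' b b' → a * a' ≈ 1 → b * b' ≈ 1 → (a * b) * (a' * b') ≈ 1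
  inverse-* a a' b b' aa'≈1 bb'≈1 = begin
    (a * b) * (a' * b')   ≡⟨ interchange a b a' b' ⟩
    (a * a') * (b * b')   ≈⟨ *-cong aa'≈1 bb'≈1 ⟩
    1                     ∎
    where
    open ≈-Reasoning
    interchange : ∀ a b a' b' → (a * b) * (a' * b') ≡ (a * a') * (b * b')
    interchange = ℕ-Solver.solve-∀

  sumℤ-reindex-* : ∀ c c' → c * c' ≈ 1 → ∀ (g : ℕ → ℤ) →
                   sumℤ n (λ x → g ((c * x) % n)) ≡ sumℤ n g
  sumℤ-reindex-* c c' cc'≈1 =
    sumℤ-reindex n (scale c) (scale c') (λ {x} _ → m%n<n (c * x) n) (λ {y} _ → m%n<n (c' * y) n)
      (cancel c' c c'c≈1) (cancel c c' cc'≈1)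
    where
    scale : ℕ → ℕ → ℕ
    scale c x = (c * x) % n
    c'c≈1 : c' * c ≈ 1
    c'c≈1 = ≈-trans (mod-≡ (cong (_% n) (ℕₚ.*-comm c' c))) cc'≈1
    cancel : ∀ a b → a * b ≈ 1 → ∀ {x} → x < n → scale a (scale b x) ≡ x
    cancel a b ab≈1 {x} x<n = ≈⇒≡ (m%n<n (a * scale b x) n) x<n (begin
      (a * ((b * x) % n)) % n   ≈⟨ %-≈ (a * scale b x) ⟩
      a * ((b * x) % n)         ≈⟨ *-cong (≈-refl {a}) (%-≈ (b * x)) ⟩
      a * (b * x)               ≡⟨ ℕₚ.*-assoc a b x ⟨
      a * b * x                 ≈⟨ *-cong ab≈1 ≈-refl ⟩
      1 * x                     ≡⟨ ℕₚ.*-identityˡ x ⟩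
      x                         ∎)
      where open ≈-Reasoning

  negated-by-scaling⇒sumℤ²≡0 : ∀ a a' b b' → a * a' ≈ 1 → b * b' ≈ 1 → (L : ℕ → ℕ → ℤ) →
                               (∀ x y → L ((a * x) % n) ((b * y) % n) ≡ - L x y) →
                               sumℤ n (λ x → sumℤ n (L x)) ≡ 0ℤ
  negated-by-scaling⇒sumℤ²≡0 a a' b b' aa'≈1 bb'≈1 L L-odd = i≡-i⇒i≡0 (begin
    sumℤ n (λ x → sumℤ n (L x))
      ≡⟨ sumℤ-cong n (λ {x} _ → sumℤ-reindex-* b b' bb'≈1 (L x)) ⟨
    sumℤ n (λ x → sumℤ n (λ y → L x ((b * y) % n)))
      ≡⟨ sumℤ-reindex-* a a' aa'≈1 (λ x → sumℤ n (λ y → L x ((b * y) % n))) ⟨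
    sumℤ n (λ x → sumℤ n (λ y → L ((a * x) % n) ((b * y) % n)))
      ≡⟨ sumℤ-cong n (λ {x} _ → sumℤ-cong n (λ {y} _ → L-odd x y)) ⟩
    sumℤ n (λ x → sumℤ n (λ y → - L x y))
      ≡⟨ sumℤ-cong n (λ {x} _ → sumℤ-neg n (L x)) ⟩
    sumℤ n (λ x → - sumℤ n (L x))
      ≡⟨ sumℤ-neg n (λ x → sumℤ n (L x)) ⟩
    - sumℤ n (λ x → sumℤ n (L x))
      ∎)
    where open ≡-Reasoning

modN≡% : ∀ a n .{{_ : NonZero n}} → modN a n ≡ a % n
modN≡% a (suc n) = refl

isSquareBelow-sound : ∀ m a n → isSquareBelow m a n ≡ true →
                      ∃ λ y → modN (y * y) m ≡ modN a m
isSquareBelow-sound m a (suc n) sq with modN (n * n) m ≡ᵇ modN a m in eq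
... | true  = n , ℕₚ.≡ᵇ⇒≡ _ _ (subst T (sym eq) _)
... | false = isSquareBelow-sound m a n sq

isSquareBelow-complete : ∀ m a {n y} → y < n → modN (y * y) m ≡ modN a m →
                         isSquareBelow m a n ≡ true
isSquareBelow-complete m a {suc n} {y} y<1+n y²≡a with modN (n * n) m ≡ᵇ modN a m in eq
... | true  = refl
... | false with ℕₚ.m<1+n⇒m<n∨m≡n y<1+n
...   | inj₁ y<n  = isSquareBelow-complete m a y<n y²≡a
...   | inj₂ refl = ⊥-elim (subst T eq (ℕₚ.≡⇒≡ᵇ _ _ y²≡a))

isSquareBelow-cong : ∀ m n {a b} → modN a m ≡ modN b m →
                     isSquareBelow m a n ≡ isSquareBelow m b n
isSquareBelow-cong m zero    a≡b = refl
isSquareBelow-cong m (suc n) a≡b rewrite a≡b | isSquareBelow-cong m n a≡b = refl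

legendre-cong : ∀ m {a b} → modN a m ≡ modN b m → legendre a m ≡ legendre b m
legendre-cong m a≡b rewrite a≡b | isSquareBelow-cong m m a≡b = refl

legendre-divisible : ∀ m {a} → modN a m ≡ 0 → legendre a m ≡ 0ℤ
legendre-divisible m a≡0 rewrite a≡0 = refl

legendre-nondivisible : ∀ m {a b} → modN a m ≢ 0 → isSquareBelow m a m ≡ b →
                        legendre a m ≡ (if b then 1ℤ else -1ℤ)
legendre-nondivisible m {a} a≢0 refl with modN a m ≡ᵇ 0 in eq
... | true  = ⊥-elim (a≢0 (ℕₚ.≡ᵇ⇒≡ _ 0 (subst T (sym eq) _)))
... | false = refl

psi-cong : ∀ m α β α' β' →
           (modN (disc α β) m ≡ 0 → modN (disc α' β') m ≡ 0) →
           (modN (disc α' β') m ≡ 0 → modN (disc α β) m ≡ 0) →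
           psi m α β ≡ psi m α' β'
psi-cong m α β α' β' ⇒ ⇐ = cong (λ b → if b then 0ℤ else 1ℤ) (≡ᵇ0-cong ⇒ ⇐)
  where
  ≡ᵇ0-cong : ∀ {x y} → (x ≡ 0 → y ≡ 0) → (y ≡ 0 → x ≡ 0) → (x ≡ᵇ 0) ≡ (y ≡ᵇ 0)
  ≡ᵇ0-cong {zero}  {zero}  _ _ = refl
  ≡ᵇ0-cong {zero}  {suc _} ⇒ _ with () ← ⇒ refl
  ≡ᵇ0-cong {suc _} {zero}  _ ⇐ with () ← ⇐ refl
  ≡ᵇ0-cong {suc _} {suc _} _ _ = refl

scaledLambda-suc : ∀ {p} k α β → (p ≡ᵇ 2) ≡ false →
                   scaledLambda p (suc k) α β ≡ proj₁ (muPair (traceA p α β) (psi p α β) p (suc k))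
scaledLambda-suc k α β p≢2 rewrite p≢2 = refl

-- muPair a ψ p (suc k) reduces to muPair-step a ψ p (muPair a ψ p k).
muPair-step : ℤ → ℤ → ℕ → ℤ × ℤ → ℤ × ℤ
muPair-step a ψ p (u , v) = v , (- a) ℤ.* v ℤ.- (+ p) ℤ.* ψ ℤ.* u

module _ (a ψ : ℤ) (p : ℕ) where

  muPair-step-neg₂ : ∀ w → muPair-step (- a) ψ p (map₂ -_ w) ≡ map₁ -_ (muPair-step a ψ p w)
  muPair-step-neg₂ (u , v) = cong (- v ,_) (identity a v (+ p ℤ.* ψ) u)
    where
    identity : ∀ a v c u → (- - a) ℤ.* (- v) ℤ.- c ℤ.* u ≡ (- a) ℤ.* v ℤ.- c ℤ.* u
    identity = ℤ-Solver.solve-∀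

  muPair-step-neg₁ : ∀ w → muPair-step (- a) ψ p (map₁ -_ w) ≡ map₂ -_ (muPair-step a ψ p w)
  muPair-step-neg₁ (u , v) = cong (v ,_) (identity a v (+ p ℤ.* ψ) u)
    where
    identity : ∀ a v c u → (- - a) ℤ.* v ℤ.- c ℤ.* (- u) ≡ - ((- a) ℤ.* v ℤ.- c ℤ.* u)
    identity = ℤ-Solver.solve-∀

  muPair-neg-even : ∀ m → muPair (- a) ψ p (2 * m) ≡ map₂ -_ (muPair a ψ p (2 * m))
  muPair-neg-odd  : ∀ m → muPair (- a) ψ p (1 + 2 * m) ≡ map₁ -_ (muPair a ψ p (1 + 2 * m))

  muPair-neg-even zero    = refl
  muPair-neg-even (suc m) =
    subst (λ k → muPair (- a) ψ p k ≡ map₂ -_ (muPair a ψ p k)) (sym (ℕₚ.*-suc 2 m))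
      (trans (cong (muPair-step (- a) ψ p) (muPair-neg-odd m))
             (muPair-step-neg₁ (muPair a ψ p (1 + 2 * m))))

  muPair-neg-odd m =
    trans (cong (muPair-step (- a) ψ p) (muPair-neg-even m))
          (muPair-step-neg₂ (muPair a ψ p (2 * m)))

module OddPrime (p : ℕ) (p-prime : Prime p) (2<p : 2 < p) where

  instance
    p-nonZero : NonZero p
    p-nonZero = prime⇒nonZero p-prime

  open Congruence p

  1<p : 1 < p
  1<p = ℕₚ.<-trans (ℕₚ.n<1+n 1) 2<p

  euclid : ∀ a b → a * b ≈ 0 → a ≈ 0 ⊎ b ≈ 0
  euclid a b ab≈0 = Sum.map ∣⇒≈0 ∣⇒≈0 (euclidsLemma a b p-prime (≈0⇒∣ ab≈0))

  *-≉0 : ∀ {a b} → a ≉ 0 → b ≉ 0 → a * b ≉ 0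
  *-≉0 {a} {b} a≉0 b≉0 = Sum.[ a≉0 , b≉0 ] ∘ euclid a b

  *-cancelˡ-≈0 : ∀ {a b} → a ≉ 0 → a * b ≈ 0 → b ≈ 0
  *-cancelˡ-≈0 {a} {b} a≉0 ab≈0 = Sum.[ ⊥-elim ∘ a≉0 , id ] (euclid a b ab≈0)

  inverse : ∀ {a} → a ≉ 0 → ∃ λ a' → a * a' ≈ 1
  inverse {a} a≉0 with inverse-of-residue (m%n<n a p) (a≉0 ∘ %≡0⇒≈0)
    where
    inverse-of-residue : ∀ {r} → r < p → r ≢ 0 → ∃ λ r' → r * r' ≈ 1
    inverse-of-residue {r} r<p r≢0
      with coprime-Bézout (prime⇒coprime p-prime {{≢-nonZero r≢0}} r<p)
    ... | Bézout.-+ x y 1+xp≡yr = y , (begin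
      r * y       ≡⟨ ℕₚ.*-comm r y ⟩
      y * r       ≡⟨ 1+xp≡yr ⟨
      1 + x * p   ≈⟨ +-multiple 1 x ⟩
      1           ∎)
      where open ≈-Reasoning
    -- Here y r ≡ -1 (mod p), so r · y (y r) = (y r)² ≡ 1.
    ... | Bézout.+- x y 1+yr≡xp = y * (y * r) , (begin
      r * (y * (y * r))               ≡⟨ rearrange₁ r y ⟩
      y * r * (y * r)                 ≡⟨ ℕₚ.+-identityʳ (y * r * (y * r)) ⟨
      y * r * (y * r) + 0             ≈⟨ +-cong (≈-refl {y * r * (y * r)}) 1+yr≈0 ⟨
      y * r * (y * r) + (1 + y * r)   ≡⟨ rearrange₂ (y * r) ⟩
      1 + y * r * (1 + y * r)         ≈⟨ +-cong (≈-refl {1}) (*-≈0 (y * r) 1+yr≈0) ⟩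
      1 + 0                           ∎)
      where
      open ≈-Reasoning
      1+yr≈0 : 1 + y * r ≈ 0
      1+yr≈0 = subst (_≈ 0) (sym 1+yr≡xp) (+-multiple 0 x)
      rearrange₁ : ∀ r y → r * (y * (y * r)) ≡ y * r * (y * r)
      rearrange₁ = ℕ-Solver.solve-∀
      rearrange₂ : ∀ u → u * u + (1 + u) ≡ 1 + u * (1 + u)
      rearrange₂ = ℕ-Solver.solve-∀
  ... | r' , rr'≈1 = r' , ≈-trans (*-cong (≈-sym (%-≈ a)) (≈-refl {r'})) rr'≈1

  square≈0⇒≡0 : ∀ {x} → x < p → x * x ≈ 0 → x ≡ 0
  square≈0⇒≡0 {x} x<p x²≈0 = <∧≈0⇒≡0 x<p (Sum.[ id , id ] (euclid x x x²≈0))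

  complement-square : ∀ x z → x + z ≡ p → z * z ≈ x * x
  complement-square x z x+z≡p = begin
    z * z                      ≈⟨ +-multiple (z * z) x ⟨
    z * z + x * p              ≡⟨ cong (λ m → z * z + x * m) x+z≡p ⟨
    z * z + x * (x + z)        ≡⟨ rearrange x z ⟩
    x * x + z * (x + z)        ≡⟨ cong (λ m → x * x + z * m) x+z≡p ⟩
    x * x + z * p              ≈⟨ +-multiple (x * x) z ⟩
    x * x                      ∎
    where
    open ≈-Reasoning
    rearrange : ∀ x z → z * z + x * (x + z) ≡ x * x + z * (x + z)
    rearrange = ℕ-Solver.solve-∀

  square-roots-ordered : ∀ {x t} → x + t < p → (x + t) * (x + t) ≈ x * x →
                         t ≡ 0 ⊎ x + t + x ≡ p
  square-roots-ordered {x} {t} x+t<p [x+t]²≈x² with euclid t (x + t + x) t[x+t+x]≈0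
    where
    expand : ∀ x t → x * x + t * (x + t + x) ≡ (x + t) * (x + t)
    expand = ℕ-Solver.solve-∀
    t[x+t+x]≈0 : t * (x + t + x) ≈ 0
    t[x+t+x]≈0 = a+b≈a⇒b≈0 (x * x) _ (subst (_≈ x * x) (sym (expand x t)) [x+t]²≈x²)
  ... | inj₁ t≈0 = inj₁ (<∧≈0⇒≡0 (ℕₚ.≤-<-trans (ℕₚ.m≤n+m t x) x+t<p) t≈0)
  ... | inj₂ x+t+x≈0
    with <2n∧≈0⇒≡0⊎≡n (ℕₚ.+-mono-< x+t<p (ℕₚ.≤-<-trans (ℕₚ.m≤m+n x t) x+t<p)) x+t+x≈0
  ...   | inj₁ x+t+x≡0 = inj₁ (ℕₚ.m+n≡0⇒n≡0 x (ℕₚ.m+n≡0⇒m≡0 (x + t) x+t+x≡0))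
  ...   | inj₂ x+t+x≡p = inj₂ x+t+x≡p

  square-roots : ∀ {x y} → x < p → y < p → x * x ≈ y * y → x ≡ y ⊎ x + y ≡ p
  square-roots {x} {y} x<p y<p x²≈y² with ℕₚ.≤-total y x
  ... | inj₁ y≤x with ℕₚ.m≤n⇒∃[o]m+o≡n y≤x
  ...   | t , refl =
    Sum.map (λ t≡0 → trans (cong (λ m → y + m) t≡0) (ℕₚ.+-identityʳ y)) id
            (square-roots-ordered x<p x²≈y²)
  square-roots {x} {y} x<p y<p x²≈y² | inj₂ x≤y with ℕₚ.m≤n⇒∃[o]m+o≡n x≤y
  ...   | t , refl =
    Sum.map (λ t≡0 → sym (trans (cong (λ m → x + m) t≡0) (ℕₚ.+-identityʳ x)))
            (trans (ℕₚ.+-comm x (x + t)))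
            (square-roots-ordered y<p (≈-sym x²≈y²))

  x+x≢p : ∀ x → x + x ≢ p
  x+x≢p x x+x≡p = Prime.notComposite p-prime (composite 2<p 2∣p)
    where
    2∣p : 2 ∣ p
    2∣p = subst (2 ∣_) (trans (cong (λ m → x + m) (ℕₚ.+-identityʳ x)) x+x≡p) (m∣m*n x)

  IsSquare : ℕ → Set
  IsSquare a = ∃ λ y → y * y ≈ a

  *-square⇒square : ∀ {a v} w → v ≉ 0 → w * w ≈ a * (v * v) → IsSquare a
  *-square⇒square {a} {v} w v≉0 w²≈av² with inverse v≉0
  ... | v⁻¹ , vv⁻¹≈1 = w * v⁻¹ , (begin
    (w * v⁻¹) * (w * v⁻¹)          ≡⟨ rearrange₁ w v⁻¹ ⟩
    (w * w) * (v⁻¹ * v⁻¹)          ≈⟨ *-cong w²≈av² (≈-refl {v⁻¹ * v⁻¹}) ⟩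
    a * (v * v) * (v⁻¹ * v⁻¹)      ≡⟨ rearrange₂ a v v⁻¹ ⟩
    a * ((v * v⁻¹) * (v * v⁻¹))    ≈⟨ *-cong (≈-refl {a}) (*-cong vv⁻¹≈1 vv⁻¹≈1) ⟩
    a * 1                          ≡⟨ ℕₚ.*-identityʳ a ⟩
    a                              ∎)
    where
    open ≈-Reasoning
    rearrange₁ : ∀ w u → (w * u) * (w * u) ≡ (w * w) * (u * u)
    rearrange₁ = ℕ-Solver.solve-∀
    rearrange₂ : ∀ a v u → a * (v * v) * (u * u) ≡ a * ((v * u) * (v * u))
    rearrange₂ = ℕ-Solver.solve-∀

  modN≡⇒≈ : ∀ {a b} → modN a p ≡ modN b p → a ≈ b
  modN≡⇒≈ {a} {b} a≡b = mod-≡ (trans (sym (modN≡% a p)) (trans a≡b (modN≡% b p)))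

  ≈⇒modN≡ : ∀ {a b} → a ≈ b → modN a p ≡ modN b p
  ≈⇒modN≡ {a} {b} (mod-≡ a≡b) = trans (modN≡% a p) (trans a≡b (sym (modN≡% b p)))

  χ : ℕ → ℤ
  χ a = legendre a p

  χ-cong : ∀ {a b} → a ≈ b → χ a ≡ χ b
  χ-cong = legendre-cong p ∘ ≈⇒modN≡

  isSquareBelow⇒square : ∀ {a} → isSquareBelow p a p ≡ true → IsSquare a
  isSquareBelow⇒square {a} sq with isSquareBelow-sound p a p sq
  ... | y , y²≡a = y , modN≡⇒≈ y²≡a

  isSquareBelow⇒nonsquare : ∀ {a} → isSquareBelow p a p ≡ false → ¬ IsSquare a
  isSquareBelow⇒nonsquare {a} sq (y , y²≈a)
    with () ← trans (sym (isSquareBelow-complete p a (m%n<n y p)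
                            (≈⇒modN≡ (≈-trans (%-square y) y²≈a))))
                    sq

  data LegendreView (a : ℕ) : Set where
    divisible  : a ≈ 0 → χ a ≡ 0ℤ → LegendreView a
    residue    : a ≉ 0 → IsSquare a → χ a ≡ 1ℤ → LegendreView a
    nonresidue : a ≉ 0 → ¬ IsSquare a → χ a ≡ -1ℤ → LegendreView a

  legendreView : ∀ a → LegendreView a
  legendreView a with a % p ≟ 0 | isSquareBelow p a p in sq
  ... | yes a≡0 | _     = divisible (%≡0⇒≈0 a≡0) (legendre-divisible p (trans (modN≡% a p) a≡0))
  ... | no  a≢0 | true  = residue (a≢0 ∘ ≈0⇒%≡0) (isSquareBelow⇒square sq)
                                  (legendre-nondivisible p (a≢0 ∘ trans (sym (modN≡% a p))) sq)
  ... | no  a≢0 | false = nonresidue (a≢0 ∘ ≈0⇒%≡0) (isSquareBelow⇒nonsquare sq)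
                                     (legendre-nondivisible p (a≢0 ∘ trans (sym (modN≡% a p))) sq)

  χ-≈0 : ∀ {a} → a ≈ 0 → χ a ≡ 0ℤ
  χ-≈0 {a} a≈0 with legendreView a
  ... | divisible _ χa≡0   = χa≡0
  ... | residue a≉0 _ _    = ⊥-elim (a≉0 a≈0)
  ... | nonresidue a≉0 _ _ = ⊥-elim (a≉0 a≈0)

  χ≤1 : ∀ a → χ a ℤ.≤ 1ℤ
  χ≤1 a with legendreView a
  ... | divisible _ χa≡0     = subst (ℤ._≤ 1ℤ) (sym χa≡0) (ℤ.+≤+ z≤n)
  ... | residue _ _ χa≡1     = ℤₚ.≤-reflexive χa≡1
  ... | nonresidue _ _ χa≡-1 = subst (ℤ._≤ 1ℤ) (sym χa≡-1) ℤ.-≤+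

  χ≡-1⇒nonresidue : ∀ {a} → χ a ≡ -1ℤ → a ≉ 0 × ¬ IsSquare a
  χ≡-1⇒nonresidue {a} χa≡-1 with legendreView a
  ... | divisible _ χa≡0     with () ← trans (sym χa≡0) χa≡-1
  ... | residue _ _ χa≡1     with () ← trans (sym χa≡1) χa≡-1
  ... | nonresidue a≉0 ¬□a _ = a≉0 , ¬□a

  χ-1 : χ 1 ≡ 1ℤ
  χ-1 with legendreView 1
  ... | divisible 1≈0 _    with () ← <∧≈0⇒≡0 1<p 1≈0
  ... | residue _ _ χ1≡1   = χ1≡1
  ... | nonresidue _ ¬□1 _ = ⊥-elim (¬□1 (1 , ≈-refl))

  δ-%-≈ : ∀ {a y} → y < p → a ≈ y → δ y (a % p) ≡ 1ℤ
  δ-%-≈ {a} y<p a≈y = δ-≡ (≈⇒≡ y<p (m%n<n a p) (≈-trans (≈-sym a≈y) (≈-sym (%-≈ a))))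

  δ-%-≉ : ∀ {a y} → a ≉ y → δ y (a % p) ≡ 0ℤ
  δ-%-≉ {a} a≉y = δ-≢ (λ y≡a%p → a≉y (≈-trans (≈-sym (%-≈ a)) (mod-≡ (cong (_% p) (sym y≡a%p)))))

  roots : ℕ → ℤ
  roots y = sumℤ p (λ x → δ y ((x * x) % p))

  roots-of-0 : roots 0 ≡ 1ℤ
  roots-of-0 = trans (sumℤ-cong p only-root) (sumℤ-δ-one p (>-nonZero⁻¹ p))
    where
    only-root : ∀ {x} → x < p → δ 0 ((x * x) % p) ≡ δ x 0
    only-root {x} x<p with x ≟ 0
    ... | yes refl = trans (δ-%-≈ (>-nonZero⁻¹ p) ≈-refl) (sym (δ-≡ {0} refl))
    ... | no  x≢0  = trans (δ-%-≉ (x≢0 ∘ square≈0⇒≡0 x<p)) (sym (δ-≢ x≢0))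

  roots-of-nonsquare : ∀ {y} → ¬ IsSquare y → roots y ≡ 0ℤ
  roots-of-nonsquare {y} ¬□y =
    trans (sumℤ-cong p (λ {x} _ → δ-%-≉ (λ x²≈y → ¬□y (x , x²≈y)))) (sumℤ-zero p)

  roots-of-nonzero-square : ∀ {y} → y < p → y ≉ 0 → IsSquare y → roots y ≡ 1ℤ ℤ.+ 1ℤ
  roots-of-nonzero-square {y} y<p y≉0 (x , x²≈y) = begin
    roots y
      ≡⟨ sumℤ-cong p two-roots ⟩
    sumℤ p (λ x → δ x x₀ ℤ.+ δ x x₁)
      ≡⟨ sumℤ-distrib-+ p (λ x → δ x x₀) (λ x → δ x x₁) ⟩
    sumℤ p (λ x → δ x x₀) ℤ.+ sumℤ p (λ x → δ x x₁)
      ≡⟨ cong₂ ℤ._+_ (sumℤ-δ-one p x₀<p) (sumℤ-δ-one p x₁<p) ⟩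
    1ℤ ℤ.+ 1ℤ
      ∎
    where
    open ≡-Reasoning
    x₀ x₁ : ℕ
    x₀ = x % p
    x₁ = p ∸ x₀
    x₀<p : x₀ < p
    x₀<p = m%n<n x p
    x₀²≈y : x₀ * x₀ ≈ y
    x₀²≈y = ≈-trans (%-square x) x²≈y
    x₀+x₁≡p : x₀ + x₁ ≡ p
    x₀+x₁≡p = ℕₚ.m+[n∸m]≡n (ℕₚ.<⇒≤ x₀<p)
    x₁²≈y : x₁ * x₁ ≈ y
    x₁²≈y = ≈-trans (complement-square x₀ x₁ x₀+x₁≡p) x₀²≈y
    x₀≢0 : x₀ ≢ 0
    x₀≢0 x₀≡0 = y≉0 (≈-trans (≈-sym x₀²≈y) (mod-≡ (cong (λ m → m * m % p) x₀≡0)))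
    x₁<p : x₁ < p
    x₁<p = ℕₚ.∸-monoʳ-< (ℕₚ.n≢0⇒n>0 x₀≢0) (ℕₚ.<⇒≤ x₀<p)
    x₀≢x₁ : x₀ ≢ x₁
    x₀≢x₁ x₀≡x₁ = x+x≢p x₀ (trans (cong (λ m → x₀ + m) x₀≡x₁) x₀+x₁≡p)
    x+x₀≡p⇒x≡x₁ : ∀ {x} → x + x₀ ≡ p → x ≡ x₁
    x+x₀≡p⇒x≡x₁ {x} x+x₀≡p = trans (sym (ℕₚ.m+n∸n≡m x x₀)) (cong (_∸ x₀) x+x₀≡p)
    two-roots : ∀ {x} → x < p → δ y ((x * x) % p) ≡ δ x x₀ ℤ.+ δ x x₁
    two-roots {x} x<p with x ≟ x₀ | x ≟ x₁
    ... | yes refl | yes x₀≡x₁ = ⊥-elim (x₀≢x₁ x₀≡x₁)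
    ... | yes refl | no  x≢x₁  =
      trans (δ-%-≈ y<p x₀²≈y) (sym (cong₂ ℤ._+_ (δ-≡ {x} refl) (δ-≢ x≢x₁)))
    ... | no  x≢x₀ | yes refl  =
      trans (δ-%-≈ y<p x₁²≈y) (sym (cong₂ ℤ._+_ (δ-≢ x≢x₀) (δ-≡ {x} refl)))
    ... | no  x≢x₀ | no  x≢x₁  =
      trans (δ-%-≉ (λ x²≈y → Sum.[ x≢x₀ , x≢x₁ ∘ x+x₀≡p⇒x≡x₁ ]
                                  (square-roots x<p x₀<p (≈-trans x²≈y (≈-sym x₀²≈y)))))
            (sym (cong₂ ℤ._+_ (δ-≢ x≢x₀) (δ-≢ x≢x₁)))

  roots≡1+χ : ∀ {y} → y < p → roots y ≡ 1ℤ ℤ.+ χ y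
  roots≡1+χ {y} y<p with legendreView y
  ... | divisible y≈0 χy≡0 rewrite <∧≈0⇒≡0 y<p y≈0 =
    trans roots-of-0 (sym (cong (λ i → 1ℤ ℤ.+ i) χy≡0))
  ... | residue y≉0 □y χy≡1 =
    trans (roots-of-nonzero-square y<p y≉0 □y) (sym (cong (λ i → 1ℤ ℤ.+ i) χy≡1))
  ... | nonresidue _ ¬□y χy≡-1 =
    trans (roots-of-nonsquare ¬□y) (sym (cong (λ i → 1ℤ ℤ.+ i) χy≡-1))

  sumℤ-roots : sumℤ p roots ≡ + p
  sumℤ-roots = begin
    sumℤ p (λ y → sumℤ p (λ x → δ y ((x * x) % p)))
      ≡⟨ sumℤ-comm p p (λ y x → δ y ((x * x) % p)) ⟩
    sumℤ p (λ x → sumℤ p (λ y → δ y ((x * x) % p)))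
      ≡⟨ sumℤ-cong p (λ {x} _ → sumℤ-δ-one p (m%n<n (x * x) p)) ⟩
    sumℤ p (λ _ → 1ℤ)
      ≡⟨ sumℤ-one p ⟩
    + p
      ∎
    where open ≡-Reasoning

  sumℤ-χ : sumℤ p χ ≡ 0ℤ
  sumℤ-χ = identityʳ-unique (+ p) (sumℤ p χ) (begin
    + p ℤ.+ sumℤ p χ                  ≡⟨ cong (ℤ._+ sumℤ p χ) (sumℤ-one p) ⟨
    sumℤ p (λ _ → 1ℤ) ℤ.+ sumℤ p χ    ≡⟨ sumℤ-distrib-+ p (λ _ → 1ℤ) χ ⟨
    sumℤ p (λ y → 1ℤ ℤ.+ χ y)         ≡⟨ sumℤ-cong p roots≡1+χ ⟨
    sumℤ p roots                      ≡⟨ sumℤ-roots ⟩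
    + p                               ∎)
    where open ≡-Reasoning

  nonresidue-exists : ∃ λ d → χ d ≡ -1ℤ
  nonresidue-exists with anyUpTo? (λ d → χ d ℤ.≟ -1ℤ) p
  ... | yes (d , _ , χd≡-1) = d , χd≡-1
  ... | no  ∄d              = ⊥-elim (1ℤ≢0ℤ (trans (sym χ-1) (sumℤ-nonneg-≡0 p χ≥0 sumℤ-χ 1<p)))
    where
    1ℤ≢0ℤ : 1ℤ ≢ 0ℤ
    1ℤ≢0ℤ ()
    χ≥0 : ∀ {y} → y < p → 0ℤ ℤ.≤ χ y
    χ≥0 {y} y<p with legendreView y
    ... | divisible _ χy≡0     = ℤₚ.≤-reflexive (sym χy≡0)
    ... | residue _ _ χy≡1     = subst (0ℤ ℤ.≤_) (sym χy≡1) (ℤ.+≤+ z≤n)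
    ... | nonresidue _ _ χy≡-1 = ⊥-elim (∄d (y , y<p , χy≡-1))

  p≢ᵇ2 : (p ≡ᵇ 2) ≡ false
  p≢ᵇ2 with p ≡ᵇ 2 in eq
  ... | true  = ⊥-elim (ℕₚ.>⇒≢ 2<p (ℕₚ.≡ᵇ⇒≡ p 2 (subst T (sym eq) _)))
  ... | false = refl

  psi-cong-≈ : ∀ α β α' β' →
               (disc α β ≈ 0 → disc α' β' ≈ 0) → (disc α' β' ≈ 0 → disc α β ≈ 0) →
               psi p α β ≡ psi p α' β'
  psi-cong-≈ α β α' β' ⇒ ⇐ = psi-cong p α β α' β'
    (≈0⇒modN≡0 (disc α' β') ∘ ⇒ ∘ modN≡0⇒≈0 (disc α β))
    (≈0⇒modN≡0 (disc α β) ∘ ⇐ ∘ modN≡0⇒≈0 (disc α' β'))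
    where
    modN≡0⇒≈0 : ∀ a → modN a p ≡ 0 → a ≈ 0
    modN≡0⇒≈0 a = %≡0⇒≈0 ∘ trans (sym (modN≡% a p))
    ≈0⇒modN≡0 : ∀ a → a ≈ 0 → modN a p ≡ 0
    ≈0⇒modN≡0 a = trans (modN≡% a p) ∘ ≈0⇒%≡0

  module NonResidue (d : ℕ) (χd≡-1 : χ d ≡ -1ℤ) where

    d≉0 : d ≉ 0
    d≉0 = proj₁ (χ≡-1⇒nonresidue χd≡-1)

    ¬□d : ¬ IsSquare d
    ¬□d = proj₂ (χ≡-1⇒nonresidue χd≡-1)

    d⁻¹ : ℕ
    d⁻¹ = proj₁ (inverse d≉0)

    dd⁻¹≈1 : d * d⁻¹ ≈ 1
    dd⁻¹≈1 = proj₂ (inverse d≉0)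

    χ-d*residue : ∀ {x} → χ x ≡ 1ℤ → χ (d * x) ≡ -1ℤ
    χ-d*residue {x} χx≡1 with legendreView x | legendreView (d * x)
    ... | divisible _ χx≡0     | _ with () ← trans (sym χx≡0) χx≡1
    ... | nonresidue _ _ χx≡-1 | _ with () ← trans (sym χx≡-1) χx≡1
    ... | residue x≉0 _ _ | divisible dx≈0 _ = ⊥-elim (*-≉0 d≉0 x≉0 dx≈0)
    ... | residue x≉0 (v , v²≈x) _ | residue _ (w , w²≈dx) _ =
      ⊥-elim (¬□d (*-square⇒square w v≉0 (≈-trans w²≈dx (*-cong (≈-refl {d}) (≈-sym v²≈x)))))
      where
      v≉0 : v ≉ 0
      v≉0 v≈0 = x≉0 (≈-trans (≈-sym v²≈x) (*-≈0 v v≈0))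
    ... | residue _ _ _ | nonresidue _ _ χdx≡-1 = χdx≡-1

    defect : ℕ → ℤ
    defect x = - (χ x ℤ.+ χ (d * x))

    defect≥0 : ∀ x → 0ℤ ℤ.≤ defect x
    defect≥0 x with legendreView x
    ... | divisible x≈0 χx≡0 =
      ℤₚ.≤-reflexive (sym (cong₂ (λ i j → - (i ℤ.+ j)) χx≡0 (χ-≈0 (*-≈0 d x≈0))))
    ... | residue _ _ χx≡1 =
      ℤₚ.≤-reflexive (sym (cong₂ (λ i j → - (i ℤ.+ j)) χx≡1 (χ-d*residue χx≡1)))
    ... | nonresidue _ _ χx≡-1 rewrite χx≡-1 =
      ℤₚ.neg-mono-≤ (ℤₚ.+-monoʳ-≤ -1ℤ (χ≤1 (d * x)))

    sumℤ-defect : sumℤ p defect ≡ 0ℤ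
    sumℤ-defect = begin
      sumℤ p defect
        ≡⟨ sumℤ-neg p (λ x → χ x ℤ.+ χ (d * x)) ⟩
      - sumℤ p (λ x → χ x ℤ.+ χ (d * x))
        ≡⟨ cong -_ (sumℤ-distrib-+ p χ (λ x → χ (d * x))) ⟩
      - (sumℤ p χ ℤ.+ sumℤ p (λ x → χ (d * x)))
        ≡⟨ cong (λ s → - (sumℤ p χ ℤ.+ s)) sumℤ-χ-d* ⟩
      - (sumℤ p χ ℤ.+ sumℤ p χ)
        ≡⟨ cong (λ s → - (s ℤ.+ s)) sumℤ-χ ⟩
      0ℤ
        ∎
      where
      open ≡-Reasoning
      sumℤ-χ-d* : sumℤ p (λ x → χ (d * x)) ≡ sumℤ p χ
      sumℤ-χ-d* = trans (sumℤ-cong p (λ {x} _ → χ-cong (≈-sym (%-≈ (d * x)))))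
                        (sumℤ-reindex-* d d⁻¹ dd⁻¹≈1 χ)

    χ-d* : ∀ x → χ (d * x) ≡ - χ x
    χ-d* x = begin
      χ (d * x)          ≡⟨ χ-cong (*-cong (≈-refl {d}) (%-≈ x)) ⟨
      χ (d * (x % p))    ≡⟨ inverseʳ-unique _ _ (ℤₚ.neg-injective defect≡0) ⟩
      - χ (x % p)        ≡⟨ cong -_ (χ-cong (%-≈ x)) ⟩
      - χ x              ∎
      where
      open ≡-Reasoning
      defect≡0 : defect (x % p) ≡ - 0ℤ
      defect≡0 = sumℤ-nonneg-≡0 p (λ {y} _ → defect≥0 y) sumℤ-defect (m%n<n x p)

    χ-d³ : ∀ y → χ (d * (d * (d * y))) ≡ - χ y
    χ-d³ y = begin
      χ (d * (d * (d * y)))   ≡⟨ χ-d* (d * (d * y)) ⟩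
      - χ (d * (d * y))       ≡⟨ cong -_ (χ-d* (d * y)) ⟩
      - - χ (d * y)           ≡⟨ ℤₚ.neg-involutive (χ (d * y)) ⟩
      χ (d * y)               ≡⟨ χ-d* y ⟩
      - χ y                   ∎
      where open ≡-Reasoning

    twist-α twist-β : ℕ → ℕ
    twist-α α = (d * d * α) % p
    twist-β β = (d * d * d * β) % p

    traceA-twist : ∀ α β → traceA p (twist-α α) (twist-β β) ≡ - traceA p α β
    traceA-twist α β = begin
      sumℤ p (χ ∘ cubic (twist-α α) (twist-β β))
        ≡⟨ sumℤ-reindex-* d d⁻¹ dd⁻¹≈1 (χ ∘ cubic (twist-α α) (twist-β β)) ⟨
      sumℤ p (λ x → χ (cubic (twist-α α) (twist-β β) ((d * x) % p)))
        ≡⟨ sumℤ-cong p (λ {x} _ → trans (χ-cong (twisted-cubic x)) (χ-d³ (cubic α β x))) ⟩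
      sumℤ p (λ x → - χ (cubic α β x))
        ≡⟨ sumℤ-neg p (χ ∘ cubic α β) ⟩
      - traceA p α β
        ∎
      where
      open ≡-Reasoning
      scaling : ∀ d α β x →
                (d * x) * (d * x) * (d * x) + (d * d * α) * (d * x) + d * d * d * β
                ≡ d * (d * (d * (x * x * x + α * x + β)))
      scaling = ℕ-Solver.solve-∀
      twisted-cubic : ∀ x → cubic (twist-α α) (twist-β β) ((d * x) % p)
                            ≈ d * (d * (d * cubic α β x))
      twisted-cubic x = ≈-trans (cubic-cong (%-≈ (d * d * α)) (%-≈ (d * d * d * β)) (%-≈ (d * x)))
                                (mod-≡ (cong (_% p) (scaling d α β x)))

    psi-twist : ∀ α β → psi p (twist-α α) (twist-β β) ≡ psi p α β
    psi-twist α β = psi-cong-≈ (twist-α α) (twist-β β) α β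
      (λ Δ'≈0 → *-cancelˡ-≈0 d⁶≉0 (≈-trans (≈-sym twisted-disc) Δ'≈0))
      (λ Δ≈0 → ≈-trans twisted-disc (*-≈0 d⁶ Δ≈0))
      where
      d³ d⁶ : ℕ
      d³ = d * d * d
      d⁶ = d³ * d³
      d⁶≉0 : d⁶ ≉ 0
      d⁶≉0 = *-≉0 d³≉0 d³≉0
        where
        d³≉0 : d³ ≉ 0
        d³≉0 = *-≉0 (*-≉0 d≉0 d≉0) d≉0
      scaling : ∀ d α β →
                4 * ((d * d * α) * (d * d * α) * (d * d * α))
                  + 27 * ((d * d * d * β) * (d * d * d * β))
                ≡ d * d * d * (d * d * d) * (4 * (α * α * α) + 27 * (β * β))
      scaling = ℕ-Solver.solve-∀
      twisted-disc : disc (twist-α α) (twist-β β) ≈ d⁶ * disc α β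
      twisted-disc = ≈-trans (disc-cong (%-≈ (d * d * α)) (%-≈ (d * d * d * β)))
                             (mod-≡ (cong (_% p) (scaling d α β)))

    scaledLambda-twist : ∀ m α β → scaledLambda p (1 + 2 * m) (twist-α α) (twist-β β)
                                   ≡ - scaledLambda p (1 + 2 * m) α β
    scaledLambda-twist m α β = begin
      scaledLambda p (1 + 2 * m) (twist-α α) (twist-β β)
        ≡⟨ scaledLambda-suc (2 * m) (twist-α α) (twist-β β) p≢ᵇ2 ⟩
      proj₁ (muPair (traceA p (twist-α α) (twist-β β)) (psi p (twist-α α) (twist-β β))
                    p (1 + 2 * m))
        ≡⟨ cong₂ (λ a ψ → proj₁ (muPair a ψ p (1 + 2 * m))) (traceA-twist α β) (psi-twist α β) ⟩
      proj₁ (muPair (- traceA p α β) (psi p α β) p (1 + 2 * m))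
        ≡⟨ cong proj₁ (muPair-neg-odd (traceA p α β) (psi p α β) p m) ⟩
      - proj₁ (muPair (traceA p α β) (psi p α β) p (1 + 2 * m))
        ≡⟨ cong -_ (scaledLambda-suc (2 * m) α β p≢ᵇ2) ⟨
      - scaledLambda p (1 + 2 * m) α β
        ∎
      where open ≡-Reasoning

    scaledQ-odd≡0 : ∀ m → scaledQ p (1 + 2 * m) ≡ 0ℤ
    scaledQ-odd≡0 m =
      negated-by-scaling⇒sumℤ²≡0 (d * d) (d⁻¹ * d⁻¹) (d * d * d) (d⁻¹ * d⁻¹ * d⁻¹)
        d²-inverse d³-inverse (scaledLambda p (1 + 2 * m)) (scaledLambda-twist m)
      where
      d²-inverse : d * d * (d⁻¹ * d⁻¹) ≈ 1
      d²-inverse = inverse-* d d⁻¹ d d⁻¹ dd⁻¹≈1 dd⁻¹≈1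
      d³-inverse : d * d * d * (d⁻¹ * d⁻¹ * d⁻¹) ≈ 1
      d³-inverse = inverse-* (d * d) (d⁻¹ * d⁻¹) d d⁻¹ d²-inverse dd⁻¹≈1

lemma4p12 : (p m : ℕ) → Prime p → scaledQ p (1 + 2 * m) ≡ 0ℤ
lemma4p12 p m p-prime with p ≟ 2
... | yes refl = refl
... | no  p≢2  = NonResidue.scaledQ-odd≡0 (proj₁ nonresidue-exists) (proj₂ nonresidue-exists) m
  where
  2<p : 2 < p
  2<p = ℕₚ.≤∧≢⇒< (nonTrivial⇒n>1 p {{prime⇒nonTrivial p-prime}}) (p≢2 ∘ sym)
  open OddPrime p p-prime 2<p
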